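{- Let $d\ge 2$ be an integer. There exist positive constants $c_1,c_2,c_3,c_4$ depending only on $d$ such that for every integer $k\ge 2$ the $d$-dimensional grid graph $G=\prod_{i=1}^d P_k$ satisfies $c_1k\le\mathrm{bdim}(G)\le c_2k$ and $c_3k^d\le \mathrm{adim}(G)\le c_4k^d$. Consequently, $\frac{\mathrm{adim}(G)}{\mathrm{bdim}(G)}$ and $\frac{\mathrm{bdim}(G)}{\dim(G)}$ can be arbitrarily large (over connected graphs $G$).
   Context: All graphs are finite, simple and undirected; $P_k$ is the path on $k$ vertices and $\prod$ denotes the Cartesian product of graphs. For vertices $x,y$ of $G$, $d(x,y)$ is the length of a shortest $x$–$y$ path, and for a positive integer $i$, $d_i(x,y)=\min\{d(x,y),i+1\}$. A set $S\subseteq V(G)$ is a resolving set if for any two distinct $x,y$ there is $z\in S$ with $d(x,z)\neq d(y,z)$; $\dim(G)$ is the minimum cardinality of a resolving set. $S$ is an adjacency resolving set if for any two distinct $x,y$ there is $z\in S$ with $d_1(x,z)\neq d_1(y,z)$; $\mathrm{adim}(G)$ is the minimum cardinality of such a set. A function $f:V(G)\to\mathbb{Z}_{\ge0}$ is a resolving broadcast if for any two distinct $x,y$ there is $z$ with $f(z)=i>0$ and $d_i(x,z)\neq d_i(y,z)$; $\mathrm{bdim}(G)$ is the minimum of $\sum_v f(v)$ over all resolving broadcasts $f$ of $G$. -}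

module Defs where

open import Data.Nat using (ℕ; zero; suc; _≤_; _<_; _⊔_; _⊓_; _*_; _^_)
open import Data.Nat.Properties using (suc-injective)
open import Data.Nat.ListAction using (sum)
open import Data.Fin using (Fin; toℕ)
open import Data.Unit using (⊤; tt)
open import Data.Empty using (⊥)
open import Data.Product using (Σ; ∃; ∃-syntax; _×_; _,_; proj₁; proj₂)
open import Data.Sum using (_⊎_; inj₁; inj₂)
open import Data.List using (List; []; _∷_; length; map; allFin; cartesianProduct)
open import Data.List.Membership.Propositional using (_∈_)
open import Data.List.Membership.Propositional.Properties using (∈-allFin; ∈-cartesianProduct⁺)
open import Data.List.Relation.Unary.Unique.Propositional using (Unique)
open import Data.List.Relation.Unary.Unique.Propositional.Properties using (allFin⁺; cartesianProduct⁺)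
open import Data.List.Relation.Unary.Any using (here)
import Data.List.Relation.Unary.AllPairs as AllPairs
import Data.List.Relation.Unary.All as All
open import Relation.Binary.PropositionalEquality using (_≡_; _≢_; refl; sym; trans)
open import Relation.Nullary using (¬_)

-- Finite simple (undirected, loopless) graphs.
-- The vertex set is a type V together with a duplicate-free list
-- enumerating all of its elements (so V is finite).

record Graph : Set₁ where
  field
    V        : Set
    _~_      : V → V → Set
    ~-sym    : ∀ {x y} → x ~ y → y ~ x
    ~-irrefl : ∀ {x} → ¬ (x ~ x)
    vertices : List V
    complete : ∀ v → v ∈ vertices
    unique   : Unique vertices

open Graph public

data Walk (G : Graph) : V G → V G → ℕ → Set where
  []  : ∀ {x} → Walk G x x 0
  _∷_ : ∀ {x y z n} → _~_ G x y → Walk G y z n → Walk G x z (suc n)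

Dist : (G : Graph) → V G → V G → ℕ → Set
Dist G x y n = Walk G x y n × (∀ m → Walk G x y m → n ≤ m)

Connected : Graph → Set
Connected G = ∀ x y → ∃[ n ] Walk G x y n

-- Truncated distance  d_i(x,y) = min{d(x,y), i+1}, as a function of d(x,y).

trunc : ℕ → ℕ → ℕ
trunc i m = m ⊓ suc i

DistinguishesDist : (G : Graph) → V G → V G → V G → Set
DistinguishesDist G z x y =
  ∃[ m ] ∃[ m' ] (Dist G x z m × Dist G y z m' × m ≢ m')

DistinguishesTrunc : (G : Graph) → ℕ → V G → V G → V G → Set
DistinguishesTrunc G i z x y =
  ∃[ m ] ∃[ m' ] (Dist G x z m × Dist G y z m' × trunc i m ≢ trunc i m')

-- Resolving sets, adjacency resolving sets, resolving broadcasts.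
-- Vertex sets are represented by duplicate-free lists.

ResolvingSet : (G : Graph) → List (V G) → Set
ResolvingSet G S = ∀ x y → x ≢ y → ∃[ z ] (z ∈ S × DistinguishesDist G z x y)

AdjResolvingSet : (G : Graph) → List (V G) → Set
AdjResolvingSet G S = ∀ x y → x ≢ y → ∃[ z ] (z ∈ S × DistinguishesTrunc G 1 z x y)

ResolvingBroadcast : (G : Graph) → (V G → ℕ) → Set
ResolvingBroadcast G f = ∀ x y → x ≢ y →
  ∃[ z ] (0 < f z × DistinguishesTrunc G (f z) z x y)

cost : (G : Graph) → (V G → ℕ) → ℕ
cost G f = sum (map f (vertices G))

IsDim : Graph → ℕ → Set
IsDim G n =
  (∃[ S ] (Unique S × ResolvingSet G S × length S ≡ n)) ×
  (∀ S → Unique S → ResolvingSet G S → n ≤ length S)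

IsAdim : Graph → ℕ → Set
IsAdim G n =
  (∃[ S ] (Unique S × AdjResolvingSet G S × length S ≡ n)) ×
  (∀ S → Unique S → AdjResolvingSet G S → n ≤ length S)

IsBdim : Graph → ℕ → Set
IsBdim G n =
  (∃[ f ] (ResolvingBroadcast G f × cost G f ≡ n)) ×
  (∀ f → ResolvingBroadcast G f → n ≤ cost G f)

n≢1+n : ∀ n → n ≢ suc n
n≢1+n zero    ()
n≢1+n (suc n) e = n≢1+n n (suc-injective e)

P : ℕ → Graph
P k = record
  { V        = Fin k
  ; _~_      = λ x y → (toℕ y ≡ suc (toℕ x)) ⊎ (toℕ x ≡ suc (toℕ y))
  ; ~-sym    = λ { (inj₁ e) → inj₂ e ; (inj₂ e) → inj₁ e }
  ; ~-irrefl = λ { (inj₁ e) → n≢1+n _ e ; (inj₂ e) → n≢1+n _ e }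
  ; vertices = allFin k
  ; complete = ∈-allFin
  ; unique   = allFin⁺ k
  }

K1 : Graph
K1 = record
  { V        = ⊤
  ; _~_      = λ _ _ → ⊥
  ; ~-sym    = λ ()
  ; ~-irrefl = λ ()
  ; vertices = tt ∷ []
  ; complete = λ { tt → here refl }
  ; unique   = All.[] AllPairs.∷ AllPairs.[]
  }

_□_ : Graph → Graph → Graph
G □ H = record
  { V        = V G × V H
  ; _~_      = λ p q → (_~_ G (proj₁ p) (proj₁ q) × proj₂ p ≡ proj₂ q)
                     ⊎ (proj₁ p ≡ proj₁ q × _~_ H (proj₂ p) (proj₂ q))
  ; ~-sym    = λ { (inj₁ (a , e)) → inj₁ (~-sym G a , sym e)
                 ; (inj₂ (e , a)) → inj₂ (sym e , ~-sym H a) }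
  ; ~-irrefl = λ { (inj₁ (a , _)) → ~-irrefl G a
                 ; (inj₂ (_ , a)) → ~-irrefl H a }
  ; vertices = cartesianProduct (vertices G) (vertices H)
  ; complete = λ { (g , h) → ∈-cartesianProduct⁺ (complete G g) (complete H h) }
  ; unique   = cartesianProduct⁺ (unique G) (unique H)
  }

_^□_ : Graph → ℕ → Graph
G ^□ zero  = K1
G ^□ suc d = G □ (G ^□ d)

Grid : ℕ → ℕ → Graph
Grid d k = P k ^□ d

module Submission where

-- If centres z ∈ Zs with radii r z tell every two
-- vertices apart by truncated distances d_{r z}, then all vertices but one lie in some
-- ball B(z, r z).  In the grid |B(z,i)| ≤ (2i+1)^d, so a resolving broadcast f gives
-- k^d ≤ Σ (3 f z)^d + 1 ≤ (3 cost f)^d + 1, i.e. k ≤ 3 cost f + 1; an adjacency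
-- resolving set S gives k^d ≤ 3^d |S| + 1.
-- Upper bounds.  The d+1 corners 0, K e₁, …, K e_d resolve the grid (the distances to
-- 0 and K e₁ fix the first coordinate; recurse), so broadcasting at strength
-- d·k ≥ diameter from them resolves it at cost d(d+1)k; all vertices form an
-- adjacency resolving set.
-- Existence of the minima: the invariants are minima over finite search spaces.

open import Defs
open import Data.Nat
open import Data.Nat.Properties
open import Data.Nat.ListAction using (sum)
open import Data.Nat.Solver using (module +-*-Solver)
open import Data.Fin as Fin using (Fin; toℕ; fromℕ<)
open import Data.Fin.Properties using (toℕ-fromℕ<; toℕ-injective; toℕ<n; toℕ-fromℕ)
open import Data.Unit using (tt)
open import Data.Empty using (⊥; ⊥-elim)
open import Data.Product using (∃-syntax; _×_; _,_; proj₁; proj₂)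
open import Data.Product.Properties using (≡-dec)
open import Data.Sum using (_⊎_; inj₁; inj₂)
open import Data.List using (List; []; _∷_; length; map; _++_; filter; concat; concatMap; applyUpTo; upTo; allFin; cartesianProduct)
open import Data.List.Properties using (length-++; length-++-sucʳ; length-map; length-applyUpTo; length-tabulate; map-cong; map-∘)
open import Data.List.Membership.Propositional using (_∈_; find; lose)
open import Data.List.Membership.Propositional.Properties
open import Data.List.Relation.Binary.Subset.Propositional using (_⊆_)
open import Data.List.Relation.Unary.Unique.Propositional using (Unique)
import Data.List.Relation.Unary.Unique.Propositional.Properties as Unique
open import Data.List.Relation.Unary.Any as Any using (here; there)
import Data.List.Relation.Unary.All as All
import Data.List.Relation.Unary.AllPairs as AllPairs
open import Relation.Binary.PropositionalEquality
open import Relation.Binary.Definitions using (DecidableEquality; tri<; tri≈; tri>)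
open import Relation.Nullary using (¬_; Dec; yes; no)
open import Relation.Nullary.Decidable using (map′; _×-dec_; _→-dec_; ¬?)
open import Function using (_∘_)

unique-⊆⇒length≤ : ∀ {A : Set} {xs ys : List A} → Unique xs → xs ⊆ ys → length xs ≤ length ys
unique-⊆⇒length≤ {xs = []} _ _ = z≤n
unique-⊆⇒length≤ {xs = x ∷ xs} {ys} (x∉xs AllPairs.∷ u) sub with ∈-∃++ (sub (here refl))
... | us , ws , refl =
  subst (suc (length xs) ≤_) (sym (length-++-sucʳ us x ws)) (s≤s (unique-⊆⇒length≤ u sub′))
  where
  -- removing the one occurrence of x from ys keeps every element of xs
  sub′ : xs ⊆ us ++ ws
  sub′ {y} y∈xs with ∈-++⁻ us (sub (there y∈xs))
  ... | inj₁ p         = ∈-++⁺ˡ p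
  ... | inj₂ (here e)  = ⊥-elim (All.lookup x∉xs y∈xs (sym e))
  ... | inj₂ (there p) = ∈-++⁺ʳ us p

length≤1 : ∀ {A : Set} {xs : List A} → Unique xs →
           (∀ {x y} → x ∈ xs → y ∈ xs → x ≢ y → ⊥) → length xs ≤ 1
length≤1 {xs = []}         _ _ = z≤n
length≤1 {xs = _ ∷ []}     _ _ = s≤s z≤n
length≤1 {xs = _ ∷ _ ∷ _} (x∉ AllPairs.∷ _) h = ⊥-elim (h (here refl) (there (here refl)) (All.head x∉))

length-cartesianProduct : ∀ {A B : Set} (xs : List A) (ys : List B) →
                          length (cartesianProduct xs ys) ≡ length xs * length ys
length-cartesianProduct []       ys = refl
length-cartesianProduct (x ∷ xs) ys =
  trans (length-++ (map (x ,_) ys))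
        (cong₂ _+_ (length-map (x ,_) ys) (length-cartesianProduct xs ys))

length-concat : ∀ {A : Set} (xss : List (List A)) → length (concat xss) ≡ sum (map length xss)
length-concat []         = refl
length-concat (xs ∷ xss) = trans (length-++ xs) (cong (length xs +_) (length-concat xss))

length≤filter+filter : ∀ {A : Set} {P : A → Set} (P? : ∀ x → Dec (P x)) {L : List A} → Unique L →
                       length L ≤ length (filter (¬? ∘ P?) L) + length (filter P? L)
length≤filter+filter P? {L} u =
  subst (length L ≤_) (length-++ (filter (¬? ∘ P?) L)) (unique-⊆⇒length≤ u sub)
  where
  sub : L ⊆ filter (¬? ∘ P?) L ++ filter P? L
  sub {x} x∈L with P? x
  ... | yes p  = ∈-++⁺ʳ _ (∈-filter⁺ P? x∈L p)
  ... | no ¬p  = ∈-++⁺ˡ (∈-filter⁺ (¬? ∘ P?) x∈L ¬p)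

union-bound : ∀ {A B : Set} {C : A → Set} {Q : B → A → Set}
              (C? : ∀ x → Dec (C x)) (Q? : ∀ z x → Dec (Q z x)) (Zs : List B) {L : List A} → Unique L →
              (∀ {x} → C x → ∃[ z ] (z ∈ Zs × Q z x)) →
              length (filter C? L) ≤ sum (map (λ z → length (filter (Q? z) L)) Zs)
union-bound {A} {B} C? Q? Zs {L} u covered = begin
  length (filter C? L)                          ≤⟨ unique-⊆⇒length≤ (Unique.filter⁺ C? u) sub ⟩
  length (concat (map parts Zs))                ≡⟨ length-concat (map parts Zs) ⟩
  sum (map length (map parts Zs))               ≡⟨ cong sum (sym (map-∘ Zs)) ⟩
  sum (map (λ z → length (parts z)) Zs)         ∎
  where
  open ≤-Reasoning
  parts : B → List A
  parts z = filter (Q? z) L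
  sub : filter C? L ⊆ concat (map parts Zs)
  sub m with ∈-filter⁻ C? {xs = L} m
  ... | x∈L , cx with covered cx
  ... | z , z∈Zs , q = ∈-concatMap⁺ parts (lose z∈Zs (∈-filter⁺ (Q? z) x∈L q))

sublists : ∀ {A : Set} → List A → List (List A)
sublists []      = [] ∷ []
sublists (v ∷ L) = map (v ∷_) (sublists L) ++ sublists L

filter∈sublists : ∀ {A : Set} {P : A → Set} (P? : ∀ x → Dec (P x)) (L : List A) → filter P? L ∈ sublists L
filter∈sublists P? []      = here refl
filter∈sublists P? (v ∷ L) with P? v
... | yes _ = ∈-++⁺ˡ (∈-map⁺ (v ∷_) (filter∈sublists P? L))
... | no  _ = ∈-++⁺ʳ _ (filter∈sublists P? L)

sum-mono : ∀ {A : Set} {g h : A → ℕ} (L : List A) → (∀ {z} → z ∈ L → g z ≤ h z) →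
           sum (map g L) ≤ sum (map h L)
sum-mono []      _  = z≤n
sum-mono (x ∷ L) le = +-mono-≤ (le (here refl)) (sum-mono L (le ∘ there))

sum≤length* : ∀ {A : Set} {g : A → ℕ} {c : ℕ} (L : List A) → (∀ z → g z ≤ c) → sum (map g L) ≤ length L * c
sum≤length* []      _  = z≤n
sum≤length* (x ∷ L) le = +-mono-≤ (le x) (sum≤length* L le)

sum-filter≤ : ∀ {A : Set} {P : A → Set} (P? : ∀ x → Dec (P x)) (g : A → ℕ) (L : List A) →
              sum (map g (filter P? L)) ≤ sum (map g L)
sum-filter≤ P? g []      = z≤n
sum-filter≤ P? g (x ∷ L) with P? x
... | yes _ = +-monoʳ-≤ (g x) (sum-filter≤ P? g L)
... | no  _ = ≤-trans (sum-filter≤ P? g L) (m≤n+m _ (g x))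

∈⇒≤sum : ∀ {A : Set} (g : A → ℕ) {u : A} {L : List A} → u ∈ L → g u ≤ sum (map g L)
∈⇒≤sum g {L = x ∷ L} (here refl) = m≤m+n (g x) _
∈⇒≤sum g {L = x ∷ L} (there u∈L) = ≤-trans (∈⇒≤sum g u∈L) (m≤n+m _ (g x))

^-superadditive : ∀ d → 1 ≤ d → ∀ a b → a ^ d + b ^ d ≤ (a + b) ^ d
^-superadditive 1 _ a b = ≤-reflexive (sym (*-distribʳ-+ 1 a b))
^-superadditive (suc d@(suc _)) _ a b = begin
  a * a ^ d + b * b ^ d              ≤⟨ +-mono-≤ (*-monoʳ-≤ a (m≤m+n (a ^ d) (b ^ d)))
                                                 (*-monoʳ-≤ b (m≤n+m (b ^ d) (a ^ d))) ⟩
  a * (a ^ d + b ^ d) + b * (a ^ d + b ^ d) ≡⟨ sym (*-distribʳ-+ _ a b) ⟩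
  (a + b) * (a ^ d + b ^ d)          ≤⟨ *-monoʳ-≤ (a + b) (^-superadditive d (s≤s z≤n) a b) ⟩
  (a + b) * (a + b) ^ d              ∎
  where open ≤-Reasoning

sum-^≤^-sum : ∀ d → 1 ≤ d → ∀ {A : Set} (c : ℕ) (g : A → ℕ) (L : List A) →
              sum (map (λ z → (c * g z) ^ d) L) ≤ (c * sum (map g L)) ^ d
sum-^≤^-sum d d≥1 c g []      = z≤n
sum-^≤^-sum d d≥1 c g (x ∷ L) = begin
  (c * g x) ^ d + sum (map (λ z → (c * g z) ^ d) L) ≤⟨ +-monoʳ-≤ _ (sum-^≤^-sum d d≥1 c g L) ⟩
  (c * g x) ^ d + (c * sum (map g L)) ^ d           ≤⟨ ^-superadditive d d≥1 _ _ ⟩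
  (c * g x + c * sum (map g L)) ^ d                 ≡⟨ cong (_^ d) (sym (*-distribˡ-+ c (g x) _)) ⟩
  (c * (g x + sum (map g L))) ^ d                   ∎
  where open ≤-Reasoning

1+2i≤3i : ∀ i → 1 ≤ i → suc (i + i) ≤ 3 * i
1+2i≤3i i i≥1 = ≤-trans (+-monoˡ-≤ (i + i) i≥1) (≤-reflexive (cong (λ t → i + (i + t)) (sym (+-identityʳ i))))

root-bound : ∀ d → 1 ≤ d → ∀ k m → k ^ d ≤ suc (m ^ d) → k ≤ suc m
root-bound d d≥1 k m h = ≮⇒≥ λ m+1<k → <-irrefl refl (begin-strict
  suc (m ^ d)         ≡⟨ +-comm 1 (m ^ d) ⟩
  m ^ d + 1           ≡⟨ cong (m ^ d +_) (sym (^-zeroˡ d)) ⟩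
  m ^ d + 1 ^ d       ≤⟨ ^-superadditive d d≥1 m 1 ⟩
  (m + 1) ^ d         ≡⟨ cong (_^ d) (+-comm m 1) ⟩
  suc m ^ d           <⟨ ^-monoˡ-< d {{>-nonZero d≥1}} m+1<k ⟩
  k ^ d               ≤⟨ h ⟩
  suc (m ^ d)         ∎)
  where open ≤-Reasoning

absorb-one : ∀ {N} c s → 2 ≤ N → N ≤ suc (c * s) → N ≤ suc c * s
absorb-one {N} c zero N≥2 h = ⊥-elim (<-irrefl refl (≤-trans N≥2 (subst (λ t → N ≤ suc t) (*-zeroʳ c) h)))
absorb-one c (suc s) N≥2 h = ≤-trans h (+-monoˡ-≤ (c * suc s) (s≤s z≤n))

-- Needed to exclude an empty adjacency resolving set.
2≤^ : ∀ d k → 1 ≤ d → 2 ≤ k → 2 ≤ k ^ d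
2≤^ (suc d) k _ k≥2 = *-mono-≤ k≥2 (subst (_≤ k ^ d) (^-zeroˡ d) (^-monoˡ-≤ d (≤-trans (s≤s z≤n) k≥2)))

-- A point a of [0, K] is determined by the two sums  a + s  and  (K - a) + s :
-- adding them recovers s, and then a.
coordinate-determined : ∀ K a b s t → a ≤ K → b ≤ K →
                        a + s ≡ b + t → (K ∸ a) + s ≡ (K ∸ b) + t → a ≡ b
coordinate-determined K a b s t a≤K b≤K e₁ e₂ = +-cancelʳ-≡ s a b (trans e₁ (cong (b +_) (sym s≡t)))
  where
  open +-*-Solver
  both : ∀ x r → x ≤ K → (x + r) + ((K ∸ x) + r) ≡ K + (r + r)
  both x r x≤K = trans (solve 3 (λ x r y → (x :+ r) :+ (y :+ r) := (x :+ y) :+ (r :+ r)) refl x r (K ∸ x))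
                       (cong (_+ (r + r)) (m+[n∸m]≡n x≤K))
  double-injective : ∀ {m n} → m + m ≡ n + n → m ≡ n
  double-injective {m} {n} e with <-cmp m n
  ... | tri< m<n _ _ = ⊥-elim (<-irrefl e (+-mono-< m<n m<n))
  ... | tri≈ _ m≡n _ = m≡n
  ... | tri> _ _ n<m = ⊥-elim (<-irrefl (sym e) (+-mono-< n<m n<m))
  s≡t : s ≡ t
  s≡t = double-injective (+-cancelˡ-≡ K _ _ (trans (sym (both a s a≤K)) (trans (cong₂ _+_ e₁ e₂) (both b t b≤K))))

window : ∀ x c i → ∣ x - c ∣ ≤ i → x ∈ applyUpTo ((c ∸ i) +_) (suc (i + i))
window x c i d = subst (_∈ applyUpTo ((c ∸ i) +_) (suc (i + i))) (m+[n∸m]≡n lo≤x)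
                       (∈-applyUpTo⁺ ((c ∸ i) +_) (s≤s x-lo≤2i))
  where
  open ≤-Reasoning
  lo = c ∸ i
  c≤lo+i : c ≤ lo + i
  c≤lo+i with ≤-total i c
  ... | inj₁ i≤c = ≤-reflexive (sym (m∸n+n≡m i≤c))
  ... | inj₂ c≤i = ≤-trans c≤i (m≤n+m i lo)
  c≤x+i : c ≤ x + i
  c≤x+i = ≤-trans (m≤n+∣m-n∣ c x) (+-monoʳ-≤ x (subst (_≤ i) (∣-∣-comm x c) d))
  lo≤x : lo ≤ x
  lo≤x = subst (lo ≤_) (m+n∸n≡m x i) (∸-monoˡ-≤ i c≤x+i)
  x≤lo+2i : x ≤ lo + (i + i)
  x≤lo+2i = begin
    x               ≤⟨ m≤n+∣m-n∣ x c ⟩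
    c + ∣ x - c ∣   ≤⟨ +-mono-≤ c≤lo+i d ⟩
    (lo + i) + i    ≡⟨ +-assoc lo i i ⟩
    lo + (i + i)    ∎
  x-lo≤2i : x ∸ lo ≤ i + i
  x-lo≤2i = subst (x ∸ lo ≤_) (m+n∸m≡n lo (i + i)) (∸-monoˡ-≤ lo x≤lo+2i)

search : ∀ {P : ℕ → Set} → (∀ n → Dec (P n)) → ∀ N →
         (∀ m → m < N → ¬ P m) ⊎ ∃[ n ] (P n × ∀ m → m < n → ¬ P m)
search P? zero = inj₁ λ _ ()
search {P} P? (suc N) with search P? N
... | inj₂ least = inj₂ least
... | inj₁ none with P? N
...   | yes p = inj₂ (N , p , none)
...   | no ¬p = inj₁ λ m m<1+N → fails (m<1+n⇒m<n∨m≡n m<1+N)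
  where
  fails : ∀ {m} → m < N ⊎ m ≡ N → ¬ P m
  fails (inj₁ m<N)  = none _ m<N
  fails (inj₂ refl) = ¬p

minimise : ∀ {A : Set} (Q : A → Set) (μ : A → ℕ) → (∀ n → Dec (∃[ a ] (Q a × μ a ≤ n))) →
           ∀ a₀ → Q a₀ → ∃[ n ] ((∃[ a ] (Q a × μ a ≡ n)) × (∀ a → Q a → n ≤ μ a))
minimise Q μ dec a₀ q₀ with search dec (suc (μ a₀))
... | inj₁ none = ⊥-elim (none (μ a₀) ≤-refl (a₀ , q₀ , ≤-refl))
... | inj₂ (n , (a , q , μa≤n) , below) =
  n , (a , q , ≤-antisym μa≤n (lower a q)) , lower
  where
  lower : ∀ a → Q a → n ≤ μ a
  lower a q = ≮⇒≥ λ μa<n → below (μ a) μa<n (a , q , ≤-refl)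

snocWalk : ∀ {G x y z n} → Walk G x y n → _~_ G y z → Walk G x z (suc n)
snocWalk []      e = e ∷ []
snocWalk (a ∷ w) e = a ∷ snocWalk w e

reverseWalk : ∀ {G x y n} → Walk G x y n → Walk G y x n
reverseWalk     []      = []
reverseWalk {G} (a ∷ w) = snocWalk (reverseWalk w) (~-sym G a)

_++ʷ_ : ∀ {G x y z m n} → Walk G x y m → Walk G y z n → Walk G x z (m + n)
[]      ++ʷ w = w
(a ∷ v) ++ʷ w = a ∷ (v ++ʷ w)

dist-unique : ∀ {G x y m n} → Dist G x y m → Dist G x y n → m ≡ n
dist-unique (w , min) (w′ , min′) = ≤-antisym (min _ w′) (min′ _ w)

walk0⇒≡ : ∀ {G x y} → Walk G x y 0 → x ≡ y
walk0⇒≡ [] = refl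

-- In G □ H, walks lift from either factor and project onto both factors;
-- hence distances add:  d((g,h),(g',h')) = d(g,g') + d(h,h').
module _ (G H : Graph) where

  liftˡ : ∀ {g g′ n} (h : V H) → Walk G g g′ n → Walk (G □ H) (g , h) (g′ , h) n
  liftˡ h []      = []
  liftˡ h (a ∷ w) = inj₁ (a , refl) ∷ liftˡ h w

  liftʳ : ∀ {h h′ n} (g : V G) → Walk H h h′ n → Walk (G □ H) (g , h) (g , h′) n
  liftʳ g []      = []
  liftʳ g (a ∷ w) = inj₂ (refl , a) ∷ liftʳ g w

  project : ∀ {p q n} → Walk (G □ H) p q n →
            ∃[ m₁ ] ∃[ m₂ ] (Walk G (proj₁ p) (proj₁ q) m₁ × Walk H (proj₂ p) (proj₂ q) m₂ × m₁ + m₂ ≡ n)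
  project [] = 0 , 0 , [] , [] , refl
  project (inj₁ (a , refl) ∷ w) with project w
  ... | m₁ , m₂ , w₁ , w₂ , eq = suc m₁ , m₂ , a ∷ w₁ , w₂ , cong suc eq
  project (inj₂ (refl , a) ∷ w) with project w
  ... | m₁ , m₂ , w₁ , w₂ , eq = m₁ , suc m₂ , w₁ , a ∷ w₂ , trans (+-suc m₁ m₂) (cong suc eq)

  dist-□ : ∀ {g g′ h h′ m n} → Dist G g g′ m → Dist H h h′ n → Dist (G □ H) (g , h) (g′ , h′) (m + n)
  dist-□ {g} {g′} {h} {h′} {m} {n} (w₁ , min₁) (w₂ , min₂) = liftˡ h w₁ ++ʷ liftʳ g′ w₂ , shortest
    where
    shortest : ∀ l → Walk (G □ H) (g , h) (g′ , h′) l → m + n ≤ l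
    shortest l w with project w
    ... | _ , _ , v₁ , v₂ , eq = subst (m + n ≤_) eq (+-mono-≤ (min₁ _ v₁) (min₂ _ v₂))

δP : ∀ {k} → Fin k → Fin k → ℕ
δP a b = ∣ toℕ a - toℕ b ∣

ascendingWalk : ∀ {k} n (a b : Fin k) → toℕ b ≡ toℕ a + n → Walk (P k) a b n
ascendingWalk zero a b b≡a+0 =
  subst (λ c → Walk _ a c 0) (toℕ-injective (trans (sym (+-identityʳ (toℕ a))) (sym b≡a+0))) []
ascendingWalk {k} (suc n) a b b≡a+1+n = inj₁ (toℕ-fromℕ< a+1<k) ∷ ascendingWalk n a′ b b≡a′+n
  where
  a+1≤b : suc (toℕ a) ≤ toℕ b
  a+1≤b = subst (suc (toℕ a) ≤_) (trans (sym (+-suc (toℕ a) n)) (sym b≡a+1+n)) (s≤s (m≤m+n (toℕ a) n))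
  a+1<k : suc (toℕ a) < k
  a+1<k = ≤-<-trans a+1≤b (toℕ<n b)
  a′ : Fin k
  a′ = fromℕ< a+1<k
  b≡a′+n : toℕ b ≡ toℕ a′ + n
  b≡a′+n = trans b≡a+1+n (trans (+-suc (toℕ a) n) (cong (_+ n) (sym (toℕ-fromℕ< a+1<k))))

walkP : ∀ {k} (a b : Fin k) → Walk (P k) a b (δP a b)
walkP a b with ≤-total (toℕ a) (toℕ b)
... | inj₁ a≤b = subst (Walk _ a b) (sym (m≤n⇒∣m-n∣≡n∸m a≤b)) (ascendingWalk _ a b (sym (m+[n∸m]≡n a≤b)))
... | inj₂ b≤a = subst (Walk _ a b) (sym (m≤n⇒∣n-m∣≡n∸m b≤a))
                       (reverseWalk (ascendingWalk _ b a (sym (m+[n∸m]≡n b≤a))))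

∣n-1+n∣≡1 : ∀ n → ∣ n - suc n ∣ ≡ 1
∣n-1+n∣≡1 zero    = refl
∣n-1+n∣≡1 (suc n) = ∣n-1+n∣≡1 n

-- Each edge of P_k changes the coordinate by one, so no walk is shorter than |a - b|.
walkP-length : ∀ {k a b m} → Walk (P k) a b m → δP a b ≤ m
walkP-length {a = a} [] = ≤-reflexive (∣n-n∣≡0 (toℕ a))
walkP-length {a = a} {b} (_∷_ {y = c} e w) =
  ≤-trans (∣-∣-triangle (toℕ a) (toℕ c) (toℕ b)) (+-mono-≤ (≤-reflexive (edge e)) (walkP-length w))
  where
  edge : (toℕ c ≡ suc (toℕ a)) ⊎ (toℕ a ≡ suc (toℕ c)) → δP a c ≡ 1
  edge (inj₁ c≡1+a) rewrite c≡1+a = ∣n-1+n∣≡1 (toℕ a)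
  edge (inj₂ a≡1+c) rewrite a≡1+c = trans (∣-∣-comm (suc (toℕ c)) (toℕ c)) (∣n-1+n∣≡1 (toℕ c))

distP : ∀ {k} (a b : Fin k) → Dist (P k) a b (δP a b)
distP a b = walkP a b , λ _ → walkP-length

δGrid : ∀ d {k} → V (Grid d k) → V (Grid d k) → ℕ
δGrid zero    _       _       = 0
δGrid (suc d) (a , x) (b , y) = δP a b + δGrid d x y

distGrid : ∀ d {k} (x y : V (Grid d k)) → Dist (Grid d k) x y (δGrid d x y)
distGrid zero        tt      tt      = [] , λ _ _ → z≤n
distGrid (suc d) {k} (a , x) (b , y) = dist-□ (P k) (Grid d k) (distP a b) (distGrid d x y)

grid-≟ : ∀ d {k} → DecidableEquality (V (Grid d k))
grid-≟ zero    tt tt = yes refl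
grid-≟ (suc d) = ≡-dec Fin._≟_ (grid-≟ d)

grid-connected : ∀ d k → Connected (Grid d k)
grid-connected d k x y = δGrid d x y , proj₁ (distGrid d x y)

grid-size : ∀ d k → length (vertices (Grid d k)) ≡ k ^ d
grid-size zero    k = refl
grid-size (suc d) k = trans (length-cartesianProduct (allFin k) (vertices (Grid d k)))
                            (cong₂ _*_ (length-tabulate {n = k} (λ i → i)) (grid-size d k))

grid-diameter : ∀ d {k} (x y : V (Grid d k)) → δGrid d x y ≤ d * k
grid-diameter zero    _       _       = z≤n
grid-diameter (suc d) (a , x) (b , y) =
  +-mono-≤ (≤-trans (∣m-n∣≤m⊔n (toℕ a) (toℕ b)) (⊔-lub (<⇒≤ (toℕ<n a)) (<⇒≤ (toℕ<n b))))
           (grid-diameter d x y)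

-- In P_k a ball of radius i has at most 2i+1 vertices: their coordinates lie in a window.
ball-path : ∀ {k} (c : Fin k) i → length (filter (λ a → δP a c ≤? i) (allFin k)) ≤ suc (i + i)
ball-path {k} c i = begin
  length B                 ≡⟨ length-map toℕ B ⟨
  length (map toℕ B)       ≤⟨ unique-⊆⇒length≤ unique-coords in-window ⟩
  length W                 ≡⟨ length-applyUpTo ((toℕ c ∸ i) +_) (suc (i + i)) ⟩
  suc (i + i)              ∎
  where
  open ≤-Reasoning
  B = filter (λ a → δP a c ≤? i) (allFin k)
  W = applyUpTo ((toℕ c ∸ i) +_) (suc (i + i))
  unique-coords : Unique (map toℕ B)
  unique-coords = Unique.map⁺ toℕ-injective (Unique.filter⁺ (λ a → δP a c ≤? i) (Unique.allFin⁺ k))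
  in-window : map toℕ B ⊆ W
  in-window m with ∈-map⁻ toℕ m
  ... | a , a∈B , refl = window (toℕ a) (toℕ c) i (proj₂ (∈-filter⁻ (λ a → δP a c ≤? i) {xs = allFin k} a∈B))

-- In the d-dimensional grid a ball of radius i has at most (2i+1)^d vertices,
-- being contained in the product of the one-dimensional balls.
ball-grid : ∀ d {k} (z : V (Grid d k)) i →
            length (filter (λ x → δGrid d x z ≤? i) (vertices (Grid d k))) ≤ suc (i + i) ^ d
ball-grid zero          z       i = s≤s z≤n
ball-grid (suc d) {k} (c , z) i = begin
  length (filter inBall Vs)          ≤⟨ unique-⊆⇒length≤ (Unique.filter⁺ inBall (unique (Grid (suc d) k))) sub ⟩
  length (cartesianProduct B₁ B₂)    ≡⟨ length-cartesianProduct B₁ B₂ ⟩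
  length B₁ * length B₂              ≤⟨ *-mono-≤ (ball-path c i) (ball-grid d z i) ⟩
  suc (i + i) * suc (i + i) ^ d      ∎
  where
  open ≤-Reasoning
  Vs = vertices (Grid (suc d) k)
  inBall = λ x → δGrid (suc d) x (c , z) ≤? i
  B₁ = filter (λ a → δP a c ≤? i) (allFin k)
  B₂ = filter (λ x → δGrid d x z ≤? i) (vertices (Grid d k))
  sub : filter inBall Vs ⊆ cartesianProduct B₁ B₂
  sub {a , x} m with ∈-filter⁻ inBall {xs = Vs} m
  ... | _ , le = ∈-cartesianProduct⁺ (∈-filter⁺ (λ a → δP a c ≤? i) (∈-allFin a) (m+n≤o⇒m≤o _ le))
                                     (∈-filter⁺ (λ x → δGrid d x z ≤? i) (complete (Grid d k) x) (m+n≤o⇒n≤o _ le))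

-- Functions A → ℕ with values ≤ n on a list L and 0 elsewhere, enumerated explicitly.
module BoundedFunctions {A : Set} (_≟_ : DecidableEquality A) where

  update : A → ℕ → (A → ℕ) → A → ℕ
  update v j g u with u ≟ v
  ... | yes _ = j
  ... | no  _ = g u

  boundedFunctions : ℕ → List A → List (A → ℕ)
  boundedFunctions n []      = (λ _ → 0) ∷ []
  boundedFunctions n (v ∷ L) = concatMap (λ g → map (λ j → update v j g) (upTo (suc n))) (boundedFunctions n L)

  boundedFunctions-complete : ∀ n L (f : A → ℕ) → (∀ {u} → u ∈ L → f u ≤ n) →
                              ∃[ g ] (g ∈ boundedFunctions n L × ∀ {u} → u ∈ L → g u ≡ f u)
  boundedFunctions-complete n []      f _       = _ , here refl , λ ()
  boundedFunctions-complete n (v ∷ L) f f≤n with boundedFunctions-complete n L f (f≤n ∘ there)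
  ... | g , g∈ , agree =
    update v (f v) g ,
    ∈-concatMap⁺ _ (Any.map (λ { refl → ∈-map⁺ _ (∈-upTo⁺ (s≤s (f≤n (here refl)))) }) g∈) ,
    agree′
    where
    agree′ : ∀ {u} → u ∈ v ∷ L → update v (f v) g u ≡ f u
    agree′ {u} m with u ≟ v
    agree′ _         | yes u≡v = cong f (sym u≡v)
    agree′ (here e)  | no  u≢v = ⊥-elim (u≢v e)
    agree′ (there p) | no  _   = agree p

module Metric (G : Graph) (_≟V_ : DecidableEquality (V G)) (δ : V G → V G → ℕ)
              (δ-dist : ∀ x y → Dist G x y (δ x y)) where

  Vs : List (V G)
  Vs = vertices G

  ∀? : ∀ {P : V G → Set} → (∀ x → Dec (P x)) → Dec (∀ x → P x)
  ∀? P? = map′ (λ all x → All.lookup all (complete G x)) (λ f → All.tabulate λ {x} _ → f x) (All.all? P? Vs)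

  ∃∈? : ∀ {P : V G → Set} (L : List (V G)) → (∀ x → Dec (P x)) → Dec (∃[ x ] (x ∈ L × P x))
  ∃∈? L P? = map′ find (λ (_ , x∈L , p) → lose x∈L p) (Any.any? P? L)

  ∃? : ∀ {P : V G → Set} → (∀ x → Dec (P x)) → Dec (∃[ x ] P x)
  ∃? P? = map′ (λ (z , _ , p) → z , p) (λ (z , p) → z , complete G z , p) (∃∈? Vs P?)

  -- Since distances are unique, distinguishing is a statement about δ.
  truncDistinguishes⇒ : ∀ {i z x y} → DistinguishesTrunc G i z x y → trunc i (δ x z) ≢ trunc i (δ y z)
  truncDistinguishes⇒ {i} {z} {x} {y} (_ , _ , dx , dy , ≢) e =
    ≢ (trans (cong (trunc i) (dist-unique dx (δ-dist x z)))
             (trans e (cong (trunc i) (dist-unique (δ-dist y z) dy))))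

  truncDistinguishes⇐ : ∀ {i z x y} → trunc i (δ x z) ≢ trunc i (δ y z) → DistinguishesTrunc G i z x y
  truncDistinguishes⇐ {z = z} {x} {y} ≢ = δ x z , δ y z , δ-dist x z , δ-dist y z , ≢

  distDistinguishes⇒ : ∀ {z x y} → DistinguishesDist G z x y → δ x z ≢ δ y z
  distDistinguishes⇒ {z} {x} {y} (_ , _ , dx , dy , ≢) e =
    ≢ (trans (dist-unique dx (δ-dist x z)) (trans e (dist-unique (δ-dist y z) dy)))

  distDistinguishes⇐ : ∀ {z x y} → δ x z ≢ δ y z → DistinguishesDist G z x y
  distDistinguishes⇐ {z} {x} {y} ≢ = δ x z , δ y z , δ-dist x z , δ-dist y z , ≢

  truncDistinguishes? : ∀ i z x y → Dec (DistinguishesTrunc G i z x y)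
  truncDistinguishes? i z x y = map′ truncDistinguishes⇐ truncDistinguishes⇒ (¬? (trunc i (δ x z) ≟ trunc i (δ y z)))

  distDistinguishes? : ∀ z x y → Dec (DistinguishesDist G z x y)
  distDistinguishes? z x y = map′ distDistinguishes⇐ distDistinguishes⇒ (¬? (δ x z ≟ δ y z))

  -- A vertex is at distance 0 only from itself, so it distinguishes itself from
  -- every other vertex, at every truncation level.
  self-distinguishes : ∀ i {x y} → x ≢ y → DistinguishesTrunc G i x x y
  self-distinguishes i {x} {y} x≢y = truncDistinguishes⇐ λ e →
    x≢y (sym (δ≡0⇒≡ (trunc≡0 (δ y x) (trans (sym e) (cong (trunc i) δ-self)))))
    where
    δ-self : δ x x ≡ 0
    δ-self = dist-unique (δ-dist x x) ([] , λ _ _ → z≤n)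
    δ≡0⇒≡ : ∀ {u v} → δ u v ≡ 0 → u ≡ v
    δ≡0⇒≡ {u} {v} e = walk0⇒≡ (subst (Walk G u v) e (proj₁ (δ-dist u v)))
    trunc≡0 : ∀ m → trunc i m ≡ 0 → m ≡ 0
    trunc≡0 zero _ = refl

  vertices-adjResolving : AdjResolvingSet G Vs
  vertices-adjResolving x y x≢y = x , complete G x , self-distinguishes 1 x≢y

  Ball : V G → ℕ → List (V G)
  Ball z i = filter (λ x → δ x z ≤? i) Vs

  -- If every pair of distinct vertices is told apart by the
  -- truncated distance d_{r z}(·, z) to some centre z ∈ Zs, then all vertices but at
  -- most one lie in a ball B(z, r z): two vertices outside all of them are at
  -- truncated distance r z + 1 from every centre.
  covering : (Zs : List (V G)) (r : V G → ℕ) →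
             (∀ x y → x ≢ y → ∃[ z ] (z ∈ Zs × trunc (r z) (δ x z) ≢ trunc (r z) (δ y z))) →
             length Vs ≤ suc (sum (map (λ z → length (Ball z (r z))) Zs))
  covering Zs r resolves = begin
    length Vs                                                ≤⟨ length≤filter+filter covered? (unique G) ⟩
    length (filter (¬? ∘ covered?) Vs) + length (filter covered? Vs)
                                                             ≤⟨ +-mono-≤ at-most-one-uncovered
                                                                         (union-bound covered? (λ z x → δ x z ≤? r z) Zs (unique G) (λ c → c)) ⟩
    suc (sum (map (λ z → length (Ball z (r z))) Zs))         ∎
    where
    open ≤-Reasoning
    covered? : ∀ x → Dec (∃[ z ] (z ∈ Zs × δ x z ≤ r z))
    covered? x = ∃∈? Zs (λ z → δ x z ≤? r z)
    far : ∀ {x} → x ∈ filter (¬? ∘ covered?) Vs → ∀ {z} → z ∈ Zs → trunc (r z) (δ x z) ≡ suc (r z)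
    far m z∈Zs = m≥n⇒m⊓n≡n (≰⇒> λ near → proj₂ (∈-filter⁻ (¬? ∘ covered?) {xs = Vs} m) (_ , z∈Zs , near))
    at-most-one-uncovered : length (filter (¬? ∘ covered?) Vs) ≤ 1
    at-most-one-uncovered = length≤1 (Unique.filter⁺ (¬? ∘ covered?) (unique G)) λ mx my x≢y →
      let (z , z∈Zs , ≢) = resolves _ _ x≢y in ≢ (trans (far mx z∈Zs) (sym (far my z∈Zs)))

  open import Data.List.Membership.DecPropositional _≟V_ using (_∈?_)

  -- From a resolving set S and a bound D ≥ 1 on the diameter: broadcasting with
  -- strength D from every vertex of S resolves G at cost at most D·|S|
  -- (this is  bdim ≤ diam · dim).
  module Spread (D : ℕ) (D≥1 : 1 ≤ D) (diameter : ∀ x y → δ x y ≤ D) (S : List (V G)) where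

    spread : V G → ℕ
    spread v with v ∈? S
    ... | yes _ = D
    ... | no  _ = 0

    spread-∈ : ∀ {z} → z ∈ S → spread z ≡ D
    spread-∈ {z} z∈S with z ∈? S
    ... | yes _   = refl
    ... | no  z∉S = ⊥-elim (z∉S z∈S)

    spread-resolves : ResolvingSet G S → ResolvingBroadcast G spread
    spread-resolves rs x y x≢y with rs x y x≢y
    ... | z , z∈S , dd =
      z , subst (1 ≤_) (sym (spread-∈ z∈S)) D≥1 ,
      subst (λ i → DistinguishesTrunc G i z x y) (sym (spread-∈ z∈S))
            (truncDistinguishes⇐ λ e → distDistinguishes⇒ dd (trans (sym (exact x)) (trans e (exact y))))
      where
      -- distances never exceed D, so truncation at level D is exact
      exact : ∀ v → trunc D (δ v z) ≡ δ v z
      exact v = m≤n⇒m⊓n≡m (m≤n⇒m≤1+n (diameter v z))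

    sum-spread : ∀ L → sum (map spread L) ≡ D * length (filter (_∈? S) L)
    sum-spread []      = sym (*-zeroʳ D)
    sum-spread (v ∷ L) with v ∈? S
    ... | yes _ = trans (cong (D +_) (sum-spread L)) (sym (*-suc D _))
    ... | no  _ = sum-spread L

    spread-cost : cost G spread ≤ D * length S
    spread-cost = begin
      cost G spread                   ≡⟨ sum-spread Vs ⟩
      D * length (filter (_∈? S) Vs)  ≤⟨ *-monoʳ-≤ D (unique-⊆⇒length≤ (Unique.filter⁺ (_∈? S) (unique G))
                                                        (λ m → proj₂ (∈-filter⁻ (_∈? S) {xs = Vs} m))) ⟩
      D * length S                    ∎
      where open ≤-Reasoning

  -- Minimum-size resolving sets exist for any decidable distinguishing relation:
  -- a resolving set may be shrunk to a duplicate-free sublist of V(G), and there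
  -- are finitely many of those to search.
  module MinimalSets (Distinguishes : V G → V G → V G → Set)
                     (distinguishes? : ∀ z x y → Dec (Distinguishes z x y)) where

    open import Data.List.Relation.Unary.Unique.DecPropositional _≟V_ using (unique?)

    Resolves : List (V G) → Set
    Resolves S = ∀ x y → x ≢ y → ∃[ z ] (z ∈ S × Distinguishes z x y)

    resolves? : ∀ S → Dec (Resolves S)
    resolves? S = ∀? λ x → ∀? λ y → ¬? (x ≟V y) →-dec ∃∈? S λ z → distinguishes? z x y

    normalise : List (V G) → List (V G)
    normalise S = filter (_∈? S) Vs

    normalise-unique : ∀ S → Unique (normalise S)
    normalise-unique S = Unique.filter⁺ (_∈? S) (unique G)

    normalise-resolves : ∀ {S} → Resolves S → Resolves (normalise S)
    normalise-resolves {S} rs x y x≢y =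
      let (z , z∈S , dz) = rs x y x≢y in z , ∈-filter⁺ (_∈? S) (complete G z) z∈S , dz

    normalise-length : ∀ S → length (normalise S) ≤ length S
    normalise-length S = unique-⊆⇒length≤ (normalise-unique S) (λ m → proj₂ (∈-filter⁻ (_∈? S) {xs = Vs} m))

    small? : ∀ n → Dec (∃[ S ] ((Unique S × Resolves S) × length S ≤ n))
    small? n with Any.any? (λ S → (unique? S ×-dec resolves? S) ×-dec (length S ≤? n)) (sublists Vs)
    ... | yes found = yes (proj₁ (find found) , proj₂ (proj₂ (find found)))
    ... | no none   = no λ (S , (_ , rs) , S≤n) →
      none (lose (filter∈sublists (_∈? S) Vs)
                 ((normalise-unique S , normalise-resolves rs) , ≤-trans (normalise-length S) S≤n))

    minimum-set : ∀ S₀ → Resolves S₀ →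
                  ∃[ n ] (((∃[ S ] (Unique S × Resolves S × length S ≡ n)) ×
                           (∀ S → Unique S → Resolves S → n ≤ length S)) × n ≤ length S₀)
    minimum-set S₀ rs₀
      with minimise (λ S → Unique S × Resolves S) length small? (normalise S₀)
                    (normalise-unique S₀ , normalise-resolves rs₀)
    ... | n , (S , (u , rs) , S≡n) , least =
      n , ((S , u , rs , S≡n) , (λ S′ u′ rs′ → least S′ (u′ , rs′))) ,
      ≤-trans (least _ (normalise-unique S₀ , normalise-resolves rs₀)) (normalise-length S₀)

  open MinimalSets (DistinguishesDist G) distDistinguishes? public using ()
    renaming (minimum-set to dim-exists)
  open MinimalSets (DistinguishesTrunc G 1) (truncDistinguishes? 1) public using ()
    renaming (minimum-set to adim-exists)

  -- Resolving broadcasts of minimum cost exist: a broadcast of cost ≤ n takes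
  -- values ≤ n, so it agrees on V(G) with one of finitely many listed functions.
  module _ where
    open BoundedFunctions _≟V_

    resolvingBroadcast? : ∀ f → Dec (ResolvingBroadcast G f)
    resolvingBroadcast? f =
      ∀? λ x → ∀? λ y → ¬? (x ≟V y) →-dec ∃? λ z → (1 ≤? f z) ×-dec truncDistinguishes? (f z) z x y

    cheap? : ∀ n → Dec (∃[ f ] (ResolvingBroadcast G f × cost G f ≤ n))
    cheap? n with Any.any? (λ g → resolvingBroadcast? g ×-dec (cost G g ≤? n)) (boundedFunctions n Vs)
    ... | yes found = yes (proj₁ (find found) , proj₂ (proj₂ (find found)))
    ... | no none   = no λ (f , rb , cost≤n) →
      let (g , g∈ , agree) = boundedFunctions-complete n Vs f (λ u∈ → ≤-trans (∈⇒≤sum f u∈) cost≤n)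
          g≗f : ∀ u → g u ≡ f u
          g≗f u = agree (complete G u)
          rb′ : ResolvingBroadcast G g
          rb′ x y x≢y = let (z , pos , dz) = rb x y x≢y in
            z , subst (0 <_) (sym (g≗f z)) pos , subst (λ i → DistinguishesTrunc G i z x y) (sym (g≗f z)) dz
      in none (lose g∈ (rb′ , subst (_≤ n) (cong sum (sym (map-cong g≗f Vs))) cost≤n))

    bdim-exists : ∀ f₀ → ResolvingBroadcast G f₀ → ∃[ n ] (IsBdim G n × n ≤ cost G f₀)
    bdim-exists f₀ rb₀ with minimise (ResolvingBroadcast G) (cost G) cheap? f₀ rb₀
    ... | n , attained , least = n , (attained , least) , least f₀ rb₀

  -- Lower bounds for graphs of polynomial growth: if every ball of radius i has at
  -- most (2i+1)^d vertices, the covering lemma bounds |V(G)| by the strength of any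
  -- resolving broadcast or adjacency resolving set.
  module Growth (d : ℕ) (d≥1 : 1 ≤ d) (ball-bound : ∀ z i → length (Ball z i) ≤ suc (i + i) ^ d) where

    -- |V| ≤ (3·cost f)^d + 1 : the active vertices z (f z ≥ 1) are centres of radius f z.
    broadcast-lower : ∀ f → ResolvingBroadcast G f → length Vs ≤ suc ((3 * cost G f) ^ d)
    broadcast-lower f rb = begin
      length Vs                                        ≤⟨ covering Active f resolves ⟩
      suc (sum (map (λ z → length (Ball z (f z))) Active)) ≤⟨ s≤s (sum-mono Active ball≤) ⟩
      suc (sum (map (λ z → (3 * f z) ^ d) Active))     ≤⟨ s≤s (sum-^≤^-sum d d≥1 3 f Active) ⟩
      suc ((3 * sum (map f Active)) ^ d)               ≤⟨ s≤s (^-monoˡ-≤ d (*-monoʳ-≤ 3 (sum-filter≤ active? f Vs))) ⟩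
      suc ((3 * cost G f) ^ d)                         ∎
      where
      open ≤-Reasoning
      active? : ∀ z → Dec (1 ≤ f z)
      active? z = 1 ≤? f z
      Active = filter active? Vs
      resolves : ∀ x y → x ≢ y → ∃[ z ] (z ∈ Active × trunc (f z) (δ x z) ≢ trunc (f z) (δ y z))
      resolves x y x≢y = let (z , pos , dz) = rb x y x≢y in
        z , ∈-filter⁺ active? (complete G z) pos , truncDistinguishes⇒ dz
      ball≤ : ∀ {z} → z ∈ Active → length (Ball z (f z)) ≤ (3 * f z) ^ d
      ball≤ {z} z∈ = ≤-trans (ball-bound z (f z))
                             (^-monoˡ-≤ d (1+2i≤3i (f z) (proj₂ (∈-filter⁻ active? {xs = Vs} z∈))))

    -- |V| ≤ 3^d·|S| + 1 : the vertices of S are centres of radius 1.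
    adjacency-lower : ∀ S → AdjResolvingSet G S → length Vs ≤ suc (length S * 3 ^ d)
    adjacency-lower S ars = begin
      length Vs                                        ≤⟨ covering S (λ _ → 1) resolves ⟩
      suc (sum (map (λ z → length (Ball z 1)) S))      ≤⟨ s≤s (sum≤length* S (λ z → ball-bound z 1)) ⟩
      suc (length S * 3 ^ d)                           ∎
      where
      open ≤-Reasoning
      resolves : ∀ x y → x ≢ y → ∃[ z ] (z ∈ S × trunc 1 (δ x z) ≢ trunc 1 (δ y z))
      resolves x y x≢y = let (z , z∈S , dz) = ars x y x≢y in z , z∈S , truncDistinguishes⇒ dz

origin : ∀ d K → V (Grid d (suc K))
origin zero    K = tt
origin (suc d) K = Fin.zero , origin d K

face₀ : ∀ d {K} → V (Grid d (suc K)) → V (Grid (suc d) (suc K))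
face₀ d x = Fin.zero , x

corners : ∀ d K → List (V (Grid d (suc K)))
corners zero    K = tt ∷ []
corners (suc d) K = map (face₀ d) (corners d K) ++ (Fin.fromℕ K , origin d K) ∷ []

origin∈corners : ∀ d K → origin d K ∈ corners d K
origin∈corners zero    K = here refl
origin∈corners (suc d) K = ∈-++⁺ˡ (∈-map⁺ (face₀ d) (origin∈corners d K))

length-corners : ∀ d K → length (corners d K) ≡ suc d
length-corners zero    K = refl
length-corners (suc d) K = begin
  length (map (face₀ d) (corners d K) ++ _ ∷ [])  ≡⟨ length-++ (map (face₀ d) (corners d K)) ⟩
  length (map (face₀ d) (corners d K)) + 1        ≡⟨ cong (_+ 1) (trans (length-map _ (corners d K)) (length-corners d K)) ⟩
  suc d + 1                                           ≡⟨ +-comm (suc d) 1 ⟩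
  suc (suc d)                                         ∎
  where open ≡-Reasoning

-- The distances to (0, o) and (K, o) are  a + δ(x, o)  and  (K - a) + δ(x, o);
-- together they determine the first coordinate a.
first-coordinate : ∀ d K (a b : Fin (suc K)) (x y : V (Grid d (suc K))) →
  δGrid (suc d) (a , x) (Fin.zero , origin d K) ≡ δGrid (suc d) (b , y) (Fin.zero , origin d K) →
  δGrid (suc d) (a , x) (Fin.fromℕ K , origin d K) ≡ δGrid (suc d) (b , y) (Fin.fromℕ K , origin d K) →
  a ≡ b
first-coordinate d K a b x y e₀ e₁ = toℕ-injective
  (coordinate-determined K (toℕ a) (toℕ b) (δGrid d x o) (δGrid d y o) (s≤s⁻¹ (toℕ<n a)) (s≤s⁻¹ (toℕ<n b))
    (trans (cong (_+ δGrid d x o) (sym (to-0 a))) (trans e₀ (cong (_+ δGrid d y o) (to-0 b))))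
    (trans (cong (_+ δGrid d x o) (sym (to-K a))) (trans e₁ (cong (_+ δGrid d y o) (to-K b)))))
  where
  o = origin d K
  to-0 : ∀ c → δP c Fin.zero ≡ toℕ c
  to-0 c = ∣-∣-identityʳ (toℕ c)
  to-K : ∀ c → δP c (Fin.fromℕ K) ≡ K ∸ toℕ c
  to-K c = trans (cong (λ t → ∣ toℕ c - t ∣) (toℕ-fromℕ K)) (m≤n⇒∣m-n∣≡n∸m (s≤s⁻¹ (toℕ<n c)))

corners-resolve : ∀ d K (x y : V (Grid d (suc K))) → x ≢ y →
                  ∃[ z ] (z ∈ corners d K × δGrid d x z ≢ δGrid d y z)
corners-resolve zero    K tt tt tt≢tt = ⊥-elim (tt≢tt refl)
corners-resolve (suc d) K (a , x) (b , y) ax≢by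
  with δGrid (suc d) (a , x) (Fin.zero , origin d K) ≟ δGrid (suc d) (b , y) (Fin.zero , origin d K)
     | δGrid (suc d) (a , x) (Fin.fromℕ K , origin d K) ≟ δGrid (suc d) (b , y) (Fin.fromℕ K , origin d K)
... | no ≢ | _    = _ , ∈-++⁺ˡ (∈-map⁺ (face₀ d) (origin∈corners d K)) , ≢
... | yes _ | no ≢ = _ , ∈-++⁺ʳ _ (here refl) , ≢
... | yes e₀ | yes e₁ with first-coordinate d K a b x y e₀ e₁
...   | refl with corners-resolve d K x y (λ x≡y → ax≢by (cong (a ,_) x≡y))
...     | z , z∈ , ≢ = (Fin.zero , z) , ∈-++⁺ˡ (∈-map⁺ (face₀ d) z∈) , ≢ ∘ +-cancelˡ-≡ (δP a Fin.zero) _ _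

module GridMetric (d k : ℕ) = Metric (Grid d k) (grid-≟ d) (δGrid d) (distGrid d)

corners-resolving : ∀ d K → ResolvingSet (Grid d (suc K)) (corners d K)
corners-resolving d K x y x≢y =
  let (z , z∈ , ≢) = corners-resolve d K x y x≢y in z , z∈ , distDistinguishes⇐ ≢
  where open GridMetric d (suc K)

-- bdim(P_k^d) ≥ k/4 : a resolving broadcast of cost B gives  k^d ≤ (3B)^d + 1.
grid-bdim-lower : ∀ d k → 1 ≤ d → 2 ≤ k → ∀ f → ResolvingBroadcast (Grid d k) f → k ≤ 4 * cost (Grid d k) f
grid-bdim-lower d k d≥1 k≥2 f rb = absorb-one 3 (cost (Grid d k) f) k≥2
  (root-bound d d≥1 k _ (subst (_≤ suc ((3 * cost (Grid d k) f) ^ d)) (grid-size d k) (broadcast-lower f rb)))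
  where open GridMetric d k; open Growth d d≥1 (ball-grid d)

-- adim(P_k^d) ≥ k^d/(3^d + 1) : every vertex lies within distance 1 of the set, but one.
grid-adim-lower : ∀ d k → 1 ≤ d → 2 ≤ k → ∀ S → AdjResolvingSet (Grid d k) S → k ^ d ≤ suc (3 ^ d) * length S
grid-adim-lower d k d≥1 k≥2 S ars = absorb-one (3 ^ d) (length S) (2≤^ d k d≥1 k≥2)
  (subst₂ (λ m n → m ≤ suc n) (grid-size d k) (*-comm (length S) (3 ^ d)) (adjacency-lower S ars))
  where open GridMetric d k; open Growth d d≥1 (ball-grid d)

-- bdim(P_k^d) ≤ d(d+1)k : broadcast at strength d·k (≥ the diameter) from the d+1 corners.
grid-broadcast : ∀ d K → 1 ≤ d →
                 ∃[ f ] (ResolvingBroadcast (Grid d (suc K)) f × cost (Grid d (suc K)) f ≤ (d * suc d) * suc K)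
grid-broadcast d K d≥1 =
  spread , spread-resolves (corners-resolving d K) , ≤-trans spread-cost (≤-reflexive rearrange)
  where
  open GridMetric d (suc K)
  open Spread (d * suc K) (*-mono-≤ d≥1 (s≤s z≤n)) (grid-diameter d) (corners d K)
  rearrange : d * suc K * length (corners d K) ≡ d * suc d * suc K
  rearrange = begin
    d * suc K * length (corners d K) ≡⟨ cong (d * suc K *_) (length-corners d K) ⟩
    d * suc K * suc d                ≡⟨ *-assoc d (suc K) (suc d) ⟩
    d * (suc K * suc d)              ≡⟨ cong (d *_) (*-comm (suc K) (suc d)) ⟩
    d * (suc d * suc K)              ≡⟨ *-assoc d (suc d) (suc K) ⟨
    d * suc d * suc K                ∎
    where open ≡-Reasoning

grid-dim : ∀ d K → ∃[ n ] (IsDim (Grid d (suc K)) n × n ≤ suc d)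
grid-dim d K =
  let (n , isDim , n≤) = dim-exists (corners d K) (corners-resolving d K)
  in n , isDim , subst (n ≤_) (length-corners d K) n≤
  where open GridMetric d (suc K)

grid-invariants : ∀ d → 1 ≤ d → ∀ k → 2 ≤ k →
  ∃[ b ] ∃[ a ] (IsBdim (Grid d k) b × IsAdim (Grid d k) a ×
                 k ≤ 4 * b × b ≤ (d * suc d) * k × k ^ d ≤ suc (3 ^ d) * a × a ≤ k ^ d)
grid-invariants d d≥1 k@(suc K) k≥2 =
  let (f , rb , cost-f≤) = grid-broadcast d K d≥1
      (b , isBdim , b≤cost-f) = bdim-exists f rb
      (a , isAdim , a≤|V|) = adim-exists Vs vertices-adjResolving
      ((f′ , rb′ , cost-f′≡b) , _) = isBdim
      ((S , _ , ars , |S|≡a) , _) = isAdim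
  in b , a , isBdim , isAdim ,
     subst (λ t → k ≤ 4 * t) cost-f′≡b (grid-bdim-lower d k d≥1 k≥2 f′ rb′) ,
     ≤-trans b≤cost-f cost-f≤ ,
     subst (λ t → k ^ d ≤ suc (3 ^ d) * t) |S|≡a (grid-adim-lower d k d≥1 k≥2 S ars) ,
     subst (a ≤_) (grid-size d k) a≤|V|
  where open GridMetric d k

-- adim/bdim is unbounded: in the k × k grid, adim ≥ k²/10 while bdim ≤ 6k.
adim/bdim-unbounded : (M : ℕ) → ∃[ G ] ∃[ a ] ∃[ b ] (Connected G × IsAdim G a × IsBdim G b × M * b < a)
adim/bdim-unbounded M =
  let (b , a , isBdim , isAdim , _ , b≤6k , k²≤10a , _) = grid-invariants 2 (s≤s z≤n) k (s≤s (s≤s z≤n))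
  in Grid 2 k , a , b , grid-connected 2 k , isAdim , isBdim , *-cancelˡ-< 10 _ _ (begin-strict
       10 * (M * b)         ≤⟨ *-monoʳ-≤ 10 (*-monoʳ-≤ M b≤6k) ⟩
       10 * (M * (6 * k))   ≡⟨ solve 2 (λ M k → con 10 :* (M :* (con 6 :* k)) := (con 10 :* (M :* con 6)) :* k) refl M k ⟩
       X * k                <⟨ *-monoˡ-< k (m<n⇒m<1+n (n<1+n X)) ⟩
       k * k                ≡⟨ cong (k *_) (*-identityʳ k) ⟨
       k ^ 2                ≤⟨ k²≤10a ⟩
       10 * a               ∎)
  where
  open ≤-Reasoning
  open +-*-Solver
  X = 10 * (M * 6)
  k = suc (suc X)

-- bdim/dim is unbounded: in the k × k grid, bdim ≥ k/4 while dim ≤ 3.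
bdim/dim-unbounded : (M : ℕ) → ∃[ G ] ∃[ b ] ∃[ n ] (Connected G × IsBdim G b × IsDim G n × M * n < b)
bdim/dim-unbounded M =
  let (b , _ , isBdim , _ , k≤4b , _) = grid-invariants 2 (s≤s z≤n) k (s≤s (s≤s z≤n))
      (n , isDim , n≤3) = grid-dim 2 (suc X)
  in Grid 2 k , b , n , grid-connected 2 k , isBdim , isDim , *-cancelˡ-< 4 _ _ (begin-strict
       4 * (M * n)          ≤⟨ *-monoʳ-≤ 4 (*-monoʳ-≤ M n≤3) ⟩
       X                    <⟨ m<n⇒m<1+n (n<1+n X) ⟩
       k                    ≤⟨ k≤4b ⟩
       4 * b                ∎)
  where
  open ≤-Reasoning
  X = 4 * (M * 3)
  k = suc (suc X)

theorem5p4 : ((d : ℕ) → 2 ≤ d →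
    ∃[ a₁ ] ∃[ c₂ ] ∃[ a₃ ] ∃[ c₄ ]
    (1 ≤ a₁ × 1 ≤ c₂ × 1 ≤ a₃ × 1 ≤ c₄ ×
    ((k : ℕ) → 2 ≤ k →
    ∃[ b ] ∃[ a ]
    (IsBdim (Grid d k) b × IsAdim (Grid d k) a ×
    k ≤ a₁ * b × b ≤ c₂ * k ×
    k ^ d ≤ a₃ * a × a ≤ c₄ * k ^ d))))
    ×
    ((M : ℕ) → ∃[ G ] ∃[ a ] ∃[ b ]
    (Connected G × IsAdim G a × IsBdim G b × M * b < a))
    ×
    ((M : ℕ) → ∃[ G ] ∃[ b ] ∃[ n ]
    (Connected G × IsBdim G b × IsDim G n × M * n < b))
-- Constants:  a₁ = 4,  c₂ = d(d+1),  a₃ = 3^d + 1,  c₄ = 1.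
theorem5p4 =
  (λ d d≥2 →
    let d≥1 = ≤-trans (s≤s z≤n) d≥2 in
    4 , d * suc d , suc (3 ^ d) , 1 , s≤s z≤n , *-mono-≤ d≥1 (s≤s z≤n) , s≤s z≤n , s≤s z≤n ,
    λ k k≥2 →
      let (b , a , isBdim , isAdim , k≤4b , b≤ , kᵈ≤ , a≤kᵈ) = grid-invariants d d≥1 k k≥2
      in b , a , isBdim , isAdim , k≤4b , b≤ , kᵈ≤ , subst (a ≤_) (sym (*-identityˡ (k ^ d))) a≤kᵈ) ,
  adim/bdim-unbounded ,
  bdim/dim-unbounded
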